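{- Let $\gamma_\sigma$ be the GES with events $\{a,b\}$, empty initial causality, and $\mathrm{Add}=\{(b,a,a)\}$. There is no SES $\sigma$ with $\mathrm{Traces}(\sigma)=\mathrm{Traces}(\gamma_\sigma)$.
   Context: A GES is $\gamma=(E,\to,\mathrm{Add})$ with $\to\subseteq E^2$ and $\mathrm{Add}\subseteq E^3$ such that $(a,c,t)\in\mathrm{Add}$ implies $\neg(c\to t)$ and $a\notin\{c,t\}$. Let $\mathrm{ic}(e)=\{e'\mid e'\to e\}$, $\mathrm{ac}(H,e)=\{e'\mid\exists a\in H.(a,e',e)\in\mathrm{Add}\}$. A trace of $\gamma$ is a sequence $e_1\cdots e_n$ of pairwise distinct events with $\mathrm{ic}(e_i)\cup\mathrm{ac}(\{e_1,\dots,e_{i-1}\},e_i)\subseteq\{e_1,\dots,e_{i-1}\}$ for all $i$. An SES is $\sigma=(E,\#,\to,\mathrm{Drop})$ with $\#\subseteq E^2$ irreflexive and symmetric, $\to\subseteq E^2$, $\mathrm{Drop}\subseteq E^3$ with $(d,c,t)\in\mathrm{Drop}$ implying $c\to t$ and $d\notin\{c,t\}$. With $\mathrm{dc}(H,e)=\{e'\mid\exists d\in H.(d,e',e)\in\mathrm{Drop}\}$, a trace of $\sigma$ is a sequence $e_1\cdots e_n$ of pairwise distinct, pairwise non-conflicting events with $\mathrm{ic}(e_i)\setminus\mathrm{dc}(\{e_1,\dots,e_{i-1}\},e_i)\subseteq\{e_1,\dots,e_{i-1}\}$ for all $i$. -}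

module Defs where

open import Data.List using (List; []; _∷_; _++_; [_])
open import Data.List.Membership.Propositional using (_∈_; _∉_)
open import Data.Product using (Σ; _×_; _,_)
open import Data.Unit using (⊤)
open import Data.Empty using (⊥)
open import Relation.Nullary using (¬_)
open import Relation.Binary.PropositionalEquality using (_≡_; _≢_)

record GES (E : Set) : Set₁ where
  field
    _⇒_   : E → E → Set
    Add   : E → E → E → Set             -- (adder, added cause, target)
    Add-wf : ∀ {a c t} → Add a c t → ¬ (c ⇒ t) × a ≢ c × a ≢ t

record SES (E : Set) : Set₁ where
  field
    _#_   : E → E → Set
    #-irrefl : ∀ {e} → ¬ (e # e)
    #-sym    : ∀ {e e'} → e # e' → e' # e
    _⇒_   : E → E → Set
    Drop  : E → E → E → Set             -- (dropper, dropped cause, target)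
    Drop-wf : ∀ {d c t} → Drop d c t → (c ⇒ t) × d ≢ c × d ≢ t

module _ {E : Set} (γ : GES E) where
  open GES γ

  GTraceFrom : List E → List E → Set
  GTraceFrom H [] = ⊤
  GTraceFrom H (e ∷ es) =
      e ∉ H
    × (∀ e' → e' ⇒ e → e' ∈ H)
    × (∀ e' → (Σ E λ a → a ∈ H × Add a e' e) → e' ∈ H)
    × GTraceFrom (H ++ [ e ]) es

  IsGTrace : List E → Set
  IsGTrace = GTraceFrom []

module _ {E : Set} (σ : SES E) where
  open SES σ

  STraceFrom : List E → List E → Set
  STraceFrom H [] = ⊤
  STraceFrom H (e ∷ es) =
      e ∉ H
    × (∀ x → x ∈ H → ¬ (x # e))
    × (∀ e' → e' ⇒ e → ¬ (Σ E λ d → d ∈ H × Drop d e' e) → e' ∈ H)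
    × STraceFrom (H ++ [ e ]) es

  IsSTrace : List E → Set
  IsSTrace = STraceFrom []

data Ev : Set where
  a b : Ev

data AddΓ : Ev → Ev → Ev → Set where
  baa : AddΓ b a a

data NoCause : Ev → Ev → Set where

γσ : GES Ev
γσ = record
  { _⇒_ = NoCause
  ; Add = AddΓ
  ; Add-wf = λ { baa → (λ ()) , (λ ()) , (λ ()) }
  }

-- In an SES, a singleton trace e forces ic(e) = ∅, since nothing can have been dropped
-- from an empty history.  Hence if x, y and xy are traces, so is yx: neither event has a
-- cause, and the conflict relation is symmetric.  In γσ the traces a, b and ab exist,
-- but ba does not, because b adds a as a cause of a.
{-# OPTIONS --safe #-}
module Submission where

open import Defs
open import Data.List using (List; []; _∷_; [_])
open import Data.List.Membership.Propositional using (_∈_; _∉_)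
open import Data.List.Relation.Unary.Any using (here)
open import Data.Product using (Σ; _×_; _,_; proj₁; proj₂)
open import Data.Unit using (tt)
open import Data.Empty using (⊥-elim)
open import Relation.Nullary using (¬_)
open import Relation.Binary.PropositionalEquality using (refl)

module _ {E : Set} (σ : SES E) where
  open SES σ

  STrace-[-]⇒no-causes : ∀ {e} → IsSTrace σ [ e ] → ∀ c → ¬ (c ⇒ e)
  STrace-[-]⇒no-causes (_ , _ , ic⊆H , _) c c⇒e with ic⊆H c c⇒e (λ { (_ , () , _) })
  ... | ()

  STrace-swap : ∀ {x y} → IsSTrace σ [ x ] → IsSTrace σ [ y ] →
                IsSTrace σ (x ∷ y ∷ []) → IsSTrace σ (y ∷ x ∷ [])
  STrace-swap {x} {y} x-trace (_ , _ , ic-y , _) (_ , _ , _ , y∉[x] , [x]∦y , _) =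
    (λ ()) , (λ _ ()) , ic-y , x∉[y] , [y]∦x , ic-x⊆[y] , tt
    where
    x∉[y] : x ∉ [ y ]
    x∉[y] (here refl) = y∉[x] (here refl)

    [y]∦x : ∀ z → z ∈ [ y ] → ¬ (z # x)
    [y]∦x _ (here refl) y#x = [x]∦y x (here refl) (#-sym y#x)

    ic-x⊆[y] : ∀ c → c ⇒ x → ¬ (Σ E λ d → d ∈ [ y ] × Drop d c x) → c ∈ [ y ]
    ic-x⊆[y] c c⇒x _ = ⊥-elim (STrace-[-]⇒no-causes x-trace c c⇒x)

γσ-a : IsGTrace γσ [ a ]
γσ-a = (λ ()) , (λ _ ()) , (λ { _ (_ , () , _) }) , tt

γσ-b : IsGTrace γσ [ b ]
γσ-b = (λ ()) , (λ _ ()) , (λ { _ (_ , () , _) }) , tt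

γσ-ab : IsGTrace γσ (a ∷ b ∷ [])
γσ-ab = (λ ()) , (λ _ ()) , (λ { _ (_ , () , _) })
      , (λ { (here ()) }) , (λ _ ()) , (λ { _ (_ , _ , ()) }) , tt

¬γσ-ba : ¬ IsGTrace γσ (b ∷ a ∷ [])
¬γσ-ba (_ , _ , _ , _ , _ , ac⊆H , _) with ac⊆H a (b , here refl , baa)
... | here ()

lemma5p10 : ¬ (Σ (SES Ev) λ σ → ∀ (l : List Ev) → (IsSTrace σ l → IsGTrace γσ l) × (IsGTrace γσ l → IsSTrace σ l))
lemma5p10 (σ , same-traces) = ¬γσ-ba (S⇒G (b ∷ a ∷ []) σ-ba)
  where
  S⇒G : ∀ l → IsSTrace σ l → IsGTrace γσ l
  S⇒G l = proj₁ (same-traces l)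

  G⇒S : ∀ l → IsGTrace γσ l → IsSTrace σ l
  G⇒S l = proj₂ (same-traces l)

  σ-ba : IsSTrace σ (b ∷ a ∷ [])
  σ-ba = STrace-swap σ (G⇒S [ a ] γσ-a) (G⇒S [ b ] γσ-b) (G⇒S (a ∷ b ∷ []) γσ-ab)
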